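{- Let $n,d$ be positive integers. (i) If $d\ge 3$ and $n\ge 2d-1$, then for every $k=1,\dots,d-2$, $EI^k(\hat{\mathcal C}_n^d)=\hat{\mathcal C}_n^{d-k}\cup\hat{\mathcal C}_n^{d-k-1}\cup\dots\cup\hat{\mathcal C}_n^{2}$. (ii) If $d\ge 2$ and $n\ge 2d-1$, then $k^{EI}(\hat{\mathcal C}_n^d)=d-1$. (iii) If $d\ge 2$ and $n\ge d$, then $k^{EI}(\hat{\mathcal P}_n^d)=d-1$ when $n\ge 2d-1$, and $k^{EI}(\hat{\mathcal P}_n^d)=n-d+1$ when $n<2d-1$.
   Context: A hypergraph $\mathcal H=(V,\mathcal E)$ consists of a finite vertex set and a set of subsets of it (hyperedges). Its edge intersection hypergraph is $EI(\mathcal H)=(V,\mathcal E^{EI})$ with $\mathcal E^{EI}=\{e_1\cap e_2 \mid e_1,e_2\in\mathcal E,\ e_1\neq e_2,\ |e_1\cap e_2|\ge 2\}$; $EI^0(\mathcal H)=\mathcal H$ and $EI^k(\mathcal H)=EI(EI^{k-1}(\mathcal H))$ for $k\ge1$. The EI-number $k^{EI}(\mathcal H)$ is the smallest nonnegative integer $k$ such that $EI^k(\mathcal H)$ has no hyperedges. The strong $d$-uniform hypercycle $\hat{\mathcal C}_n^d$ has vertex set $\{v_1,\dots,v_n\}$ and hyperedges $e_i=\{v_i,v_{i+1},\dots,v_{i+d-1}\}$ for $i=1,\dots,n$ (indices modulo $n$). The strong $d$-uniform hyperpath $\hat{\mathcal P}_n^d$ has vertex set $\{v_1,\dots,v_n\}$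 and hyperedges $e_i=\{v_i,\dots,v_{i+d-1}\}$ for $i=1,\dots,n-d+1$. The union of hypergraphs on the same vertex set is the hypergraph on that vertex set whose edge set is the union of their edge sets. -}

module Defs where

open import Data.Nat using (ℕ; zero; suc; _+_; _∸_; _≤_; _<_; _≤?_; _<?_; NonZero)
open import Data.Nat.DivMod using (_%_)
open import Data.Fin using (Fin; toℕ)
open import Data.Fin.Subset using (Subset; _∩_; ∣_∣)
open import Data.Fin.Properties using (any?)
open import Data.Vec using (tabulate)
open import Data.Bool using (Bool)
open import Data.Product using (Σ; ∃; _×_)
open import Relation.Nullary using (¬_; ⌊_⌋)
open import Relation.Nullary.Decidable using (_×-dec_)
open import Relation.Binary.PropositionalEquality using (_≡_; _≢_)
import Data.Nat as N

-- A hypergraph on the vertex set Fin n (vertices v_1..v_n are 0..n-1),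
-- given by its set of hyperedges, i.e. a predicate on subsets of Fin n.
Hypergraph : ℕ → Set₁
Hypergraph n = Subset n → Set

_≅_ : ∀ {n} → Hypergraph n → Hypergraph n → Set
H ≅ G = ∀ e → (H e → G e) × (G e → H e)

EI : ∀ {n} → Hypergraph n → Hypergraph n
EI H e = Σ _ λ e₁ → Σ _ λ e₂ →
  H e₁ × H e₂ × e₁ ≢ e₂ × e ≡ e₁ ∩ e₂ × 2 ≤ ∣ e ∣

EI^ : ∀ {n} → ℕ → Hypergraph n → Hypergraph n
EI^ zero H = H
EI^ (suc k) H = EI (EI^ k H)

NoEdges : ∀ {n} → Hypergraph n → Set
NoEdges H = ∀ e → ¬ H e

IsEINumber : ∀ {n} → Hypergraph n → ℕ → Set
IsEINumber H k = NoEdges (EI^ k H) × (∀ j → j < k → ¬ NoEdges (EI^ j H))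

-- hyperedge e_i = {v_i, ..., v_{i+d-1}} of the strong hypercycle (indices mod n)
cycEdge : (n d : ℕ) .{{_ : NonZero n}} → Fin n → Subset n
cycEdge n d i = tabulate λ j → ⌊ any? (λ (t : Fin d) → ((toℕ i + toℕ t) % n) N.≟ toℕ j) ⌋

HCycle : (n d : ℕ) .{{_ : NonZero n}} → Hypergraph n
HCycle n d e = ∃ λ (i : Fin n) → e ≡ cycEdge n d i

-- hyperedge {v_i, ..., v_{i+d-1}} (0-indexed start i) of the strong hyperpath
pathEdge : (n d i : ℕ) → Subset n
pathEdge n d i = tabulate λ j → ⌊ (i ≤? toℕ j) ×-dec (toℕ j <? i + d) ⌋

HPath : (n d : ℕ) → Hypergraph n
HPath n d e = ∃ λ (i : ℕ) → i + d ≤ n × e ≡ pathEdge n d i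

CycleUnion : (n m : ℕ) .{{_ : NonZero n}} → Hypergraph n
CycleUnion n m e = ∃ λ (c : ℕ) → 2 ≤ c × c ≤ m × HCycle n c e

-- An edge of EI^k of the strong hyperpath is an intersection e_j ∩ ⋯ ∩ e_i of at
-- least k + 1 consecutive edges, i.e. the interval [i, j + d) with i − j ≥ k; it has
-- at least two vertices only if k + 2 ≤ d, it fits only if k + d ≤ n, and every such
-- interval occurs. On the strong hypercycle with 2d ≤ n + 1, two distinct arcs of
-- length at most m cannot wrap round to meet at both ends, so they meet in one arc
-- of length less than m, and every arc of length c < m is the intersection of two
-- arcs of length m. Hence if the edges of H are arcs of length at most m, including
-- all arcs of length m, then EI(H) consists of the arcs of lengths 2, …, m − 1, and
-- both EI-numbers are read off from these descriptions.
module Submission where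

open import Defs
open import Data.Nat using (ℕ; zero; suc; pred; _+_; _*_; _∸_; _≤_; _<_; z≤n; s≤s; _≤?_; _<?_; _⊔_; _⊓_; _%_; _≟_; NonZero; >-nonZero⁻¹)
open import Data.Nat.Properties
open import Algebra.Properties.CommutativeSemigroup +-commutativeSemigroup using (x∙yz≈y∙xz)
open import Data.Nat.DivMod using (%-distribˡ-+; m%n%n≡m%n; m%n<n; m<n⇒m%n≡m; [m+n]%n≡m%n; n%n≡0)
open import Data.Fin using (Fin; toℕ; fromℕ<) renaming (zero to fzero; suc to fsuc)
open import Data.Fin.Properties using (toℕ-injective; toℕ-fromℕ<; toℕ<n; any?) renaming (suc-injective to fsuc-injective; _≟_ to _≟ᶠ_)
open import Data.Fin.Subset using (Subset; _∩_; ∣_∣; _∈_; _⊆_; ⁅_⁆; inside; outside)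
open import Data.Fin.Subset.Properties
  using (⊆-antisym; x∈p∩q⁺; x∈p∩q⁻; ∩-comm; ∩-idem; x∈⁅y⁆⇒x≡y; x≢y⇒x∉⁅y⁆; ∣⁅x⁆∣≡1; p⊂q⇒∣p∣<∣q∣)
open import Data.Vec using (_∷_; tabulate; here; there)
open import Data.Vec.Properties using ([]=⇒lookup; lookup⇒[]=; lookup∘tabulate)
open import Data.Bool using (Bool; true)
open import Data.Bool.Properties using (T-≡)
open import Data.Product using (∃; ∃₂; _×_; _,_; proj₁; proj₂)
open import Data.Sum using (_⊎_; inj₁; inj₂)
open import Data.Empty using (⊥; ⊥-elim)
open import Function using (_∘_)
open import Function.Bundles using (Equivalence)
open import Relation.Nullary using (¬_; Dec; yes; no; ⌊_⌋; contradiction)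
open import Relation.Nullary.Decidable using (toWitness; fromWitness; _×-dec_)
open import Relation.Binary.PropositionalEquality
open import Relation.Binary using (tri<; tri≈; tri>)

∈-tabulate⁻ : ∀ {n} {f : Fin n → Bool} {x} → x ∈ tabulate f → f x ≡ true
∈-tabulate⁻ {f = f} {x} x∈ = trans (sym (lookup∘tabulate f x)) ([]=⇒lookup x∈)

∈-tabulate⁺ : ∀ {n} {f : Fin n → Bool} {x} → f x ≡ true → x ∈ tabulate f
∈-tabulate⁺ {f = f} {x} fx = lookup⇒[]= x (tabulate f) (trans (lookup∘tabulate f x) fx)

module _ {n} {P : Fin n → Set} (P? : ∀ x → Dec (P x)) where

  ∈-tabulate-dec⁻ : ∀ {x} → x ∈ tabulate (λ y → ⌊ P? y ⌋) → P x
  ∈-tabulate-dec⁻ x∈ = toWitness (Equivalence.from T-≡ (∈-tabulate⁻ x∈))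

  ∈-tabulate-dec⁺ : ∀ {x} → P x → x ∈ tabulate (λ y → ⌊ P? y ⌋)
  ∈-tabulate-dec⁺ {x} p = ∈-tabulate⁺ (Equivalence.to T-≡ (fromWitness {a? = P? x} p))

1≤∣p∣⇒nonempty : ∀ {n} (p : Subset n) → 1 ≤ ∣ p ∣ → ∃ λ x → x ∈ p
1≤∣p∣⇒nonempty (inside ∷ p) _ = fzero , here
1≤∣p∣⇒nonempty (outside ∷ p) h with 1≤∣p∣⇒nonempty p h
... | x , x∈p = fsuc x , there x∈p

2≤∣p∣⇒distinct : ∀ {n} (p : Subset n) → 2 ≤ ∣ p ∣ → ∃₂ λ x y → x ≢ y × x ∈ p × y ∈ p
2≤∣p∣⇒distinct (inside ∷ p) (s≤s h) with 1≤∣p∣⇒nonempty p h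
... | y , y∈p = fzero , fsuc y , (λ ()) , here , there y∈p
2≤∣p∣⇒distinct (outside ∷ p) h with 2≤∣p∣⇒distinct p h
... | x , y , x≢y , x∈p , y∈p = fsuc x , fsuc y , x≢y ∘ fsuc-injective , there x∈p , there y∈p

distinct⇒2≤∣p∣ : ∀ {n} {p : Subset n} {x y} → x ≢ y → x ∈ p → y ∈ p → 2 ≤ ∣ p ∣
distinct⇒2≤∣p∣ {p = p} {x} {y} x≢y x∈p y∈p =
  subst (_< ∣ p ∣) (∣⁅x⁆∣≡1 x) (p⊂q⇒∣p∣<∣q∣ (⁅x⁆⊆p , y , y∈p , x≢y⇒x∉⁅y⁆ (x≢y ∘ sym)))
  where
  ⁅x⁆⊆p : ⁅ x ⁆ ⊆ p
  ⁅x⁆⊆p z∈⁅x⁆ = subst (_∈ p) (sym (x∈⁅y⁆⇒x≡y x z∈⁅x⁆)) x∈p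

EI-cong : ∀ {n} {H G : Hypergraph n} → H ≅ G → EI H ≅ EI G
EI-cong H≅G e =
  (λ (e₁ , e₂ , h₁ , h₂ , rest) → e₁ , e₂ , proj₁ (H≅G e₁) h₁ , proj₁ (H≅G e₂) h₂ , rest) ,
  (λ (e₁ , e₂ , g₁ , g₂ , rest) → e₁ , e₂ , proj₂ (H≅G e₁) g₁ , proj₂ (H≅G e₂) g₂ , rest)

≅-trans : ∀ {n} {H G K : Hypergraph n} → H ≅ G → G ≅ K → H ≅ K
≅-trans H≅G G≅K e = proj₁ (G≅K e) ∘ proj₁ (H≅G e) , proj₂ (H≅G e) ∘ proj₂ (G≅K e)

interval : (n a b : ℕ) → Subset n
interval n a b = tabulate λ x → ⌊ (a ≤? toℕ x) ×-dec (toℕ x <? b) ⌋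

module _ {n a b : ℕ} where

  ∈-interval⁻ : ∀ {x} → x ∈ interval n a b → a ≤ toℕ x × toℕ x < b
  ∈-interval⁻ = ∈-tabulate-dec⁻ λ x → (a ≤? toℕ x) ×-dec (toℕ x <? b)

  ∈-interval⁺ : ∀ {x} → a ≤ toℕ x → toℕ x < b → x ∈ interval n a b
  ∈-interval⁺ a≤x x<b = ∈-tabulate-dec⁺ (λ x → (a ≤? toℕ x) ×-dec (toℕ x <? b)) (a≤x , x<b)

  fromℕ<∈interval : ∀ {m} (m<n : m < n) → a ≤ m → m < b → fromℕ< m<n ∈ interval n a b
  fromℕ<∈interval m<n a≤m m<b =
    ∈-interval⁺ (subst (a ≤_) (sym (toℕ-fromℕ< m<n)) a≤m) (subst (_< b) (sym (toℕ-fromℕ< m<n)) m<b)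

  2≤∣interval∣⁻ : 2 ≤ ∣ interval n a b ∣ → 2 + a ≤ b
  2≤∣interval∣⁻ size with 2≤∣p∣⇒distinct (interval n a b) size
  ... | x , y , x≢y , x∈ , y∈ with ∈-interval⁻ x∈ | ∈-interval⁻ y∈ | <-cmp (toℕ x) (toℕ y)
  ... | a≤x , _ | _ , y<b | tri< x<y _ _ = ≤-trans (s≤s (≤-trans (s≤s a≤x) x<y)) y<b
  ... | _ | _ | tri≈ _ x≡y _ = contradiction (toℕ-injective x≡y) x≢y
  ... | _ , x<b | a≤y , _ | tri> _ _ y<x = ≤-trans (s≤s (≤-trans (s≤s a≤y) y<x)) x<b

  2≤∣interval∣⁺ : 2 + a ≤ b → b ≤ n → 2 ≤ ∣ interval n a b ∣
  2≤∣interval∣⁺ 2+a≤b b≤n = distinct⇒2≤∣p∣ distinct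
      (fromℕ<∈interval a<n ≤-refl (≤-trans (n≤1+n _) 2+a≤b))
      (fromℕ<∈interval a+1<n (n≤1+n a) 2+a≤b)
    where
    a+1<n : suc a < n
    a+1<n = ≤-trans 2+a≤b b≤n
    a<n : a < n
    a<n = ≤-trans (n≤1+n _) a+1<n
    distinct : fromℕ< a<n ≢ fromℕ< a+1<n
    distinct eq = 1+n≢n (trans (sym (toℕ-fromℕ< a+1<n)) (trans (cong toℕ (sym eq)) (toℕ-fromℕ< a<n)))

interval-∩ : ∀ {n} a b a′ b′ → interval n a b ∩ interval n a′ b′ ≡ interval n (a ⊔ a′) (b ⊓ b′)
interval-∩ a b a′ b′ = ⊆-antisym l⊆r r⊆l
  where
  l⊆r : ∀ {x} → x ∈ interval _ a b ∩ interval _ a′ b′ → x ∈ interval _ (a ⊔ a′) (b ⊓ b′)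
  l⊆r x∈ with x∈p∩q⁻ _ _ x∈
  ... | x∈₁ , x∈₂ with ∈-interval⁻ x∈₁ | ∈-interval⁻ x∈₂
  ... | a≤x , x<b | a′≤x , x<b′ = ∈-interval⁺ (⊔-lub a≤x a′≤x) (⊓-glb x<b x<b′)
  r⊆l : ∀ {x} → x ∈ interval _ (a ⊔ a′) (b ⊓ b′) → x ∈ interval _ a b ∩ interval _ a′ b′
  r⊆l x∈ with ∈-interval⁻ x∈
  ... | a⊔a′≤x , x<b⊓b′ = x∈p∩q⁺
    (∈-interval⁺ (m⊔n≤o⇒m≤o a a′ a⊔a′≤x) (m<n⊓o⇒m<n b b′ x<b⊓b′) ,
     ∈-interval⁺ (m⊔n≤o⇒n≤o a a′ a⊔a′≤x) (m<n⊓o⇒m<o b b′ x<b⊓b′))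

-- interval n i (j + d) is e_j ∩ e_{j+1} ∩ ⋯ ∩ e_i, so j + k ≤ i says that it is an
-- intersection of at least k + 1 consecutive path edges.
PathSpan : (n d k : ℕ) → Subset n → Set
PathSpan n d k e = ∃₂ λ j i → j + k ≤ i × i + d ≤ n × e ≡ interval n i (j + d)

widen-span : ∀ {a b a′ b′} k → a + k ≤ b → (a′ < a × b ≤ b′) ⊎ (a′ ≤ a × b < b′) → a′ + suc k ≤ b′
widen-span {a′ = a′} k a+k≤b (inj₁ (a′<a , b≤b′)) =
  ≤-trans (≤-reflexive (+-suc a′ k)) (≤-trans (+-monoˡ-≤ k a′<a) (≤-trans a+k≤b b≤b′))
widen-span {a′ = a′} k a+k≤b (inj₂ (a′≤a , b<b′)) =
  ≤-trans (≤-reflexive (+-suc a′ k)) (≤-trans (s≤s (+-monoˡ-≤ k a′≤a)) (≤-trans (s≤s a+k≤b) b<b′))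

merge-spans : ∀ {j₁ i₁ j₂ i₂} k → j₁ + k ≤ i₁ → j₂ + k ≤ i₂ → ¬ (j₁ ≡ j₂ × i₁ ≡ i₂) →
              j₁ ⊓ j₂ + suc k ≤ i₁ ⊔ i₂
merge-spans {j₁} {i₁} {j₂} {i₂} k s₁ s₂ ≢ with <-cmp j₁ j₂ | <-cmp i₁ i₂
... | tri< j₁<j₂ _ _ | _ = widen-span k s₂ (inj₁ (≤-<-trans (m⊓n≤m j₁ j₂) j₁<j₂ , m≤n⊔m i₁ i₂))
... | tri> _ _ j₂<j₁ | _ = widen-span k s₁ (inj₁ (≤-<-trans (m⊓n≤n j₁ j₂) j₂<j₁ , m≤m⊔n i₁ i₂))
... | tri≈ _ refl _ | tri< i₁<i₂ _ _ = widen-span k s₁ (inj₂ (m⊓n≤m j₁ j₁ , <-≤-trans i₁<i₂ (m≤n⊔m i₁ i₂)))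
... | tri≈ _ refl _ | tri≈ _ i₁≡i₂ _ = contradiction (refl , i₁≡i₂) ≢
... | tri≈ _ refl _ | tri> _ _ i₂<i₁ = widen-span k s₂ (inj₂ (m⊓n≤n j₁ j₁ , <-≤-trans i₂<i₁ (m≤m⊔n i₁ i₂)))

EI^-HPath⇒PathSpan : ∀ {n d} k {e} → EI^ k (HPath n d) e → PathSpan n d k e
EI^-HPath⇒PathSpan zero (i , i+d≤n , refl) = i , i , ≤-reflexive (+-identityʳ i) , i+d≤n , refl
EI^-HPath⇒PathSpan {n} {d} (suc k) (_ , _ , h₁ , h₂ , e₁≢e₂ , refl , _)
  with EI^-HPath⇒PathSpan k h₁ | EI^-HPath⇒PathSpan k h₂
... | j₁ , i₁ , s₁ , b₁ , refl | j₂ , i₂ , s₂ , b₂ , refl =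
  j₁ ⊓ j₂ , i₁ ⊔ i₂ , merge-spans k s₁ s₂ (λ { (refl , refl) → e₁≢e₂ refl }) ,
  subst (_≤ n) (sym (+-distribʳ-⊔ d i₁ i₂)) (⊔-lub b₁ b₂) ,
  trans (interval-∩ i₁ (j₁ + d) i₂ (j₂ + d)) (cong (interval n (i₁ ⊔ i₂)) (sym (+-distribʳ-⊓ d j₁ j₂)))

EI^-HPath-bounds : ∀ {n d} k {e} → 2 ≤ d → EI^ k (HPath n d) e → 2 + k ≤ d × k + d ≤ n
EI^-HPath-bounds {d = d} zero 2≤d (i , i+d≤n , _) = 2≤d , ≤-trans (m≤n+m d i) i+d≤n
EI^-HPath-bounds {n} {d} (suc k) _ edge@(_ , _ , _ , _ , _ , _ , 2≤∣e∣) with EI^-HPath⇒PathSpan (suc k) edge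
... | j , i , j+k≤i , i+d≤n , refl = +-cancelˡ-≤ j (2 + suc k) d 2+k≤d , ≤-trans (+-monoˡ-≤ d k≤i) i+d≤n
  where
  open ≤-Reasoning
  k≤i : suc k ≤ i
  k≤i = ≤-trans (m≤n+m (suc k) j) j+k≤i
  2+k≤d : j + (2 + suc k) ≤ j + d
  2+k≤d = begin
    j + (2 + suc k) ≡⟨ x∙yz≈y∙xz j 2 (suc k) ⟩
    2 + (j + suc k) ≤⟨ s≤s (s≤s j+k≤i) ⟩
    2 + i           ≤⟨ 2≤∣interval∣⁻ {n} 2≤∣e∣ ⟩
    j + d           ∎

interval∈EI^HPath : ∀ {n d} k j → 2 + k ≤ d → j + k + d ≤ n → EI^ k (HPath n d) (interval n (j + k) (j + d))
interval∈EI^HPath {n} {d} zero j _ b = j + 0 , b , cong (interval n (j + 0)) (cong (_+ d) (sym (+-identityʳ j)))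
interval∈EI^HPath {n} {d} (suc k) j 3+k≤d b =
  interval n (j + k) (j + d) , interval n (suc j + k) (suc j + d) ,
  interval∈EI^HPath k j 2+k≤d (≤-trans (n≤1+n _) b′) , interval∈EI^HPath k (suc j) 2+k≤d b′ ,
  distinct , sym intersection , 2≤∣interval∣⁺ size j+d≤n
  where
  open ≤-Reasoning
  2+k≤d : 2 + k ≤ d
  2+k≤d = ≤-trans (n≤1+n _) 3+k≤d
  b′ : suc j + k + d ≤ n
  b′ = subst (λ t → t + d ≤ n) (+-suc j k) b
  j+d≤n : j + d ≤ n
  j+d≤n = ≤-trans (+-monoˡ-≤ d (m≤m+n j (suc k))) b
  j+d<n : j + d < n
  j+d<n = ≤-trans (s≤s (+-monoˡ-≤ d (m≤m+n j k))) b′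
  size : 2 + (j + suc k) ≤ j + d
  size = begin
    2 + (j + suc k) ≡⟨ x∙yz≈y∙xz j 2 (suc k) ⟨
    j + (2 + suc k) ≤⟨ +-monoʳ-≤ j 3+k≤d ⟩
    j + d           ∎
  intersection : interval n (j + k) (j + d) ∩ interval n (suc (j + k)) (suc (j + d)) ≡ interval n (j + suc k) (j + d)
  intersection = trans (interval-∩ (j + k) (j + d) (suc (j + k)) (suc (j + d)))
    (cong₂ (interval n) (trans (m≤n⇒m⊔n≡n (n≤1+n _)) (sym (+-suc j k))) (m≤n⇒m⊓n≡m (n≤1+n _)))
  distinct : interval n (j + k) (j + d) ≢ interval n (suc (j + k)) (suc (j + d))
  distinct eq = <-irrefl (toℕ-fromℕ< j+d<n) (proj₂ (∈-interval⁻ (subst (fromℕ< j+d<n ∈_) (sym eq) j+d∈)))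
    where
    j+d∈ : fromℕ< j+d<n ∈ interval n (suc (j + k)) (suc (j + d))
    j+d∈ = fromℕ<∈interval j+d<n (≤-trans (≤-reflexive (sym (+-suc j k))) (≤-trans (m≤n+m (j + suc k) 2) size)) ≤-refl

IsEINumber-HPath : ∀ {n d} K → 2 ≤ d → ¬ (2 + K ≤ d × K + d ≤ n) →
                   (∀ j → j < K → 2 + j ≤ d × j + d ≤ n) → IsEINumber (HPath n d) K
IsEINumber-HPath K 2≤d ¬bounds bounds =
  (λ _ edge → ¬bounds (EI^-HPath-bounds K 2≤d edge)) ,
  λ j j<K noEdges → noEdges _ (interval∈EI^HPath j 0 (proj₁ (bounds j j<K)) (proj₂ (bounds j j<K)))

[m%d+n]%d≡[m+n]%d : ∀ m n d .{{_ : NonZero d}} → (m % d + n) % d ≡ (m + n) % d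
[m%d+n]%d≡[m+n]%d m n d = begin
  (m % d + n) % d         ≡⟨ %-distribˡ-+ (m % d) n d ⟩
  (m % d % d + n % d) % d ≡⟨ cong (λ t → (t + n % d) % d) (m%n%n≡m%n m d) ⟩
  (m % d + n % d) % d     ≡⟨ %-distribˡ-+ m n d ⟨
  (m + n) % d             ∎
  where open ≡-Reasoning

[m+n%d]%d≡[m+n]%d : ∀ m n d .{{_ : NonZero d}} → (m + n % d) % d ≡ (m + n) % d
[m+n%d]%d≡[m+n]%d m n d = begin
  (m + n % d) % d ≡⟨ cong (_% d) (+-comm m (n % d)) ⟩
  (n % d + m) % d ≡⟨ [m%d+n]%d≡[m+n]%d n m d ⟩
  (n + m) % d     ≡⟨ cong (_% d) (+-comm n m) ⟩
  (m + n) % d     ∎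
  where open ≡-Reasoning

%-wrap : ∀ {m} d .{{_ : NonZero d}} → m < d + d → m % d ≡ m ⊎ m % d + d ≡ m
%-wrap {m} d m<2d with m <? d
... | yes m<d = inj₁ (m<n⇒m%n≡m m<d)
... | no m≮d = inj₂ (begin
  m % d + d             ≡⟨ cong (λ t → t % d + d) m∸d+d≡m ⟨
  (m ∸ d + d) % d + d   ≡⟨ cong (_+ d) ([m+n]%n≡m%n (m ∸ d) d) ⟩
  (m ∸ d) % d + d       ≡⟨ cong (_+ d) (m<n⇒m%n≡m m∸d<d) ⟩
  m ∸ d + d             ≡⟨ m∸d+d≡m ⟩
  m                     ∎)
  where
  open ≡-Reasoning
  m∸d+d≡m : m ∸ d + d ≡ m
  m∸d+d≡m = m∸n+n≡m (≮⇒≥ m≮d)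
  m∸d<d : m ∸ d < d
  m∸d<d = +-cancelʳ-< d (m ∸ d) d (subst (_< d + d) (sym m∸d+d≡m) m<2d)

m+m≤1+n⇒m≤n : ∀ {m n} → m + m ≤ suc n → m ≤ n
m+m≤1+n⇒m≤n {zero} _ = z≤n
m+m≤1+n⇒m≤n {suc m} (s≤s m+1+m≤n) = ≤-trans (m≤n+m (suc m) m) m+1+m≤n

≤pred⇒< : ∀ {c m} → 1 ≤ c → c ≤ pred m → c < m
≤pred⇒< {m = zero} 1≤c c≤0 = contradiction (≤-trans 1≤c c≤0) λ ()
≤pred⇒< {m = suc m} _ c≤m = s≤s c≤m

distinct<⇒2≤ : ∀ {u v c} → u ≢ v → u < c → v < c → 2 ≤ c
distinct<⇒2≤ {zero} {zero} u≢v _ _ = contradiction refl u≢v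
distinct<⇒2≤ {suc u} _ (s≤s (s≤s _)) _ = s≤s (s≤s z≤n)
distinct<⇒2≤ {zero} {suc v} _ _ (s≤s (s≤s _)) = s≤s (s≤s z≤n)

b⊓[a∸s]<m : ∀ {a b m} s → s < a → a ≤ m → b ≤ m → (s ≡ 0 → a ≢ b) → b ⊓ (a ∸ s) < m
b⊓[a∸s]<m {a} {b} zero _ a≤m b≤m a≢b with <-cmp a b
... | tri< a<b _ _ = ≤-trans (s≤s (m⊓n≤n b a)) (≤-trans a<b b≤m)
... | tri≈ _ a≡b _ = contradiction a≡b (a≢b refl)
... | tri> _ _ b<a = ≤-trans (s≤s (m⊓n≤m b a)) (≤-trans b<a a≤m)
b⊓[a∸s]<m {a} {b} (suc s) s<a a≤m _ _ =
  ≤-trans (s≤s (m⊓n≤n b _)) (≤-trans (∸-monoʳ-< {a} {suc s} {0} (s≤s z≤n) (<⇒≤ s<a)) a≤m)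

module Cycle (N : ℕ) .{{_ : NonZero N}} where

  arc : Fin N → ℕ → Subset N
  arc i c = cycEdge N c i

  shift : Fin N → ℕ → Fin N
  shift i t = fromℕ< (m%n<n (toℕ i + t) N)

  dist : Fin N → Fin N → ℕ
  dist i j = (toℕ j + (N ∸ toℕ i)) % N

  toℕ-shift : ∀ i t → toℕ (shift i t) ≡ (toℕ i + t) % N
  toℕ-shift i t = toℕ-fromℕ< (m%n<n (toℕ i + t) N)

  dist<N : ∀ i j → dist i j < N
  dist<N i j = m%n<n _ N

  i+[N∸i]≡N : ∀ i → toℕ i + (N ∸ toℕ i) ≡ N
  i+[N∸i]≡N i = m+[n∸m]≡n (<⇒≤ (toℕ<n i))

  shift-dist : ∀ i j → shift i (dist i j) ≡ j
  shift-dist i j = toℕ-injective (begin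
    toℕ (shift i (dist i j))                   ≡⟨ toℕ-shift i (dist i j) ⟩
    (toℕ i + (toℕ j + (N ∸ toℕ i)) % N) % N    ≡⟨ [m+n%d]%d≡[m+n]%d (toℕ i) _ N ⟩
    (toℕ i + (toℕ j + (N ∸ toℕ i))) % N        ≡⟨ cong (_% N) (x∙yz≈y∙xz (toℕ i) (toℕ j) _) ⟩
    (toℕ j + (toℕ i + (N ∸ toℕ i))) % N        ≡⟨ cong (λ t → (toℕ j + t) % N) (i+[N∸i]≡N i) ⟩
    (toℕ j + N) % N                            ≡⟨ [m+n]%n≡m%n (toℕ j) N ⟩
    toℕ j % N                                  ≡⟨ m<n⇒m%n≡m (toℕ<n j) ⟩
    toℕ j                                      ∎)
    where open ≡-Reasoning

  dist-shift : ∀ i {t} → t < N → dist i (shift i t) ≡ t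
  dist-shift i {t} t<N = begin
    (toℕ (shift i t) + (N ∸ toℕ i)) % N        ≡⟨ cong (λ u → (u + (N ∸ toℕ i)) % N) (toℕ-shift i t) ⟩
    ((toℕ i + t) % N + (N ∸ toℕ i)) % N        ≡⟨ [m%d+n]%d≡[m+n]%d (toℕ i + t) _ N ⟩
    (toℕ i + t + (N ∸ toℕ i)) % N              ≡⟨ cong (λ u → (u + (N ∸ toℕ i)) % N) (+-comm (toℕ i) t) ⟩
    (t + toℕ i + (N ∸ toℕ i)) % N              ≡⟨ cong (_% N) (+-assoc t (toℕ i) _) ⟩
    (t + (toℕ i + (N ∸ toℕ i))) % N            ≡⟨ cong (λ u → (t + u) % N) (i+[N∸i]≡N i) ⟩
    (t + N) % N                                ≡⟨ [m+n]%n≡m%n t N ⟩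
    t % N                                      ≡⟨ m<n⇒m%n≡m t<N ⟩
    t                                          ∎
    where open ≡-Reasoning

  shift-+ : ∀ i a b → shift (shift i a) b ≡ shift i (a + b)
  shift-+ i a b = toℕ-injective (begin
    toℕ (shift (shift i a) b)     ≡⟨ toℕ-shift (shift i a) b ⟩
    (toℕ (shift i a) + b) % N     ≡⟨ cong (λ u → (u + b) % N) (toℕ-shift i a) ⟩
    ((toℕ i + a) % N + b) % N     ≡⟨ [m%d+n]%d≡[m+n]%d (toℕ i + a) b N ⟩
    (toℕ i + a + b) % N           ≡⟨ cong (_% N) (+-assoc (toℕ i) a b) ⟩
    (toℕ i + (a + b)) % N         ≡⟨ toℕ-shift i (a + b) ⟨
    toℕ (shift i (a + b))         ∎)
    where open ≡-Reasoning

  shift-% : ∀ i t → shift i (t % N) ≡ shift i t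
  shift-% i t = toℕ-injective (trans (toℕ-shift i (t % N))
    (trans ([m+n%d]%d≡[m+n]%d (toℕ i) t N) (sym (toℕ-shift i t))))

  shift-N : ∀ i → shift i N ≡ i
  shift-N i = toℕ-injective (trans (toℕ-shift i N)
    (trans ([m+n]%n≡m%n (toℕ i) N) (m<n⇒m%n≡m (toℕ<n i))))

  dist-injective : ∀ i {x y} → dist i x ≡ dist i y → x ≡ y
  dist-injective i {x} {y} eq = trans (sym (shift-dist i x)) (trans (cong (shift i) eq) (shift-dist i y))

  dist-self : ∀ i → dist i i ≡ 0
  dist-self i = trans (cong (_% N) (i+[N∸i]≡N i)) (n%n≡0 N)

  dist-trans : ∀ i j k → dist i k ≡ (dist i j + dist j k) % N
  dist-trans i j k = begin
    dist i k                                           ≡⟨ cong (dist i) k≡ ⟨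
    dist i (shift i ((dist i j + dist j k) % N))       ≡⟨ dist-shift i (m%n<n _ N) ⟩
    (dist i j + dist j k) % N                          ∎
    where
    open ≡-Reasoning
    k≡ : shift i ((dist i j + dist j k) % N) ≡ k
    k≡ = begin
      shift i ((dist i j + dist j k) % N)        ≡⟨ shift-% i _ ⟩
      shift i (dist i j + dist j k)              ≡⟨ shift-+ i (dist i j) (dist j k) ⟨
      shift (shift i (dist i j)) (dist j k)      ≡⟨ cong (λ u → shift u (dist j k)) (shift-dist i j) ⟩
      shift j (dist j k)                         ≡⟨ shift-dist j k ⟩
      k                                          ∎

  round-trip%N≡0 : ∀ i j → (dist i j + dist j i) % N ≡ 0
  round-trip%N≡0 i j = trans (sym (dist-trans i j i)) (dist-self i)

  dist-trans-< : ∀ i j k → dist i j + dist j k < N → dist i k ≡ dist i j + dist j k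
  dist-trans-< i j k s<N = trans (dist-trans i j k) (m<n⇒m%n≡m s<N)

  dist-round-trip : ∀ {i j} → i ≢ j → dist i j + dist j i ≡ N
  dist-round-trip {i} {j} i≢j with %-wrap N (+-mono-< (dist<N i j) (dist<N j i))
  ... | inj₁ sum%N≡sum = contradiction (dist-injective i dist≡0) (i≢j ∘ sym)
    where
    dist≡0 : dist i j ≡ dist i i
    dist≡0 = trans (m+n≡0⇒m≡0 _ (trans (sym sum%N≡sum) (round-trip%N≡0 i j))) (sym (dist-self i))
  ... | inj₂ sum%N+N≡sum = sym (trans (cong (_+ N) (sym (round-trip%N≡0 i j))) sum%N+N≡sum)

  dist-back : ∀ j {s} → s < N → dist (shift j (N ∸ s)) j ≡ s
  dist-back j {s} s<N = begin
    dist (shift j (N ∸ s)) j                              ≡⟨ cong (dist (shift j (N ∸ s))) j≡ ⟨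
    dist (shift j (N ∸ s)) (shift (shift j (N ∸ s)) s)    ≡⟨ dist-shift _ s<N ⟩
    s                                                     ∎
    where
    open ≡-Reasoning
    j≡ : shift (shift j (N ∸ s)) s ≡ j
    j≡ = trans (shift-+ j (N ∸ s) s) (trans (cong (shift j) (m∸n+n≡m (<⇒≤ s<N))) (shift-N j))

  ∈-arc⁻ : ∀ {i x c} → c ≤ N → x ∈ arc i c → dist i x < c
  ∈-arc⁻ {i} {x} c≤N x∈ with ∈-tabulate-dec⁻ (λ y → any? λ t → ((toℕ i + toℕ t) % N) ≟ toℕ y) x∈
  ... | t , eq =
    subst (_< _) (trans (sym (dist-shift i (≤-trans (toℕ<n t) c≤N))) (cong (dist i) shift≡x)) (toℕ<n t)
    where
    shift≡x : shift i (toℕ t) ≡ x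
    shift≡x = toℕ-injective (trans (toℕ-shift i (toℕ t)) eq)

  ∈-arc⁺ : ∀ {i x c} → dist i x < c → x ∈ arc i c
  ∈-arc⁺ {i} {x} {c} d<c = ∈-tabulate-dec⁺ (λ y → any? λ t → ((toℕ i + toℕ t) % N) ≟ toℕ y)
    (fromℕ< d<c , (begin
      (toℕ i + toℕ (fromℕ< d<c)) % N  ≡⟨ cong (λ u → (toℕ i + u) % N) (toℕ-fromℕ< d<c) ⟩
      (toℕ i + dist i x) % N          ≡⟨ toℕ-shift i (dist i x) ⟨
      toℕ (shift i (dist i x))        ≡⟨ cong toℕ (shift-dist i x) ⟩
      toℕ x                           ∎))
    where open ≡-Reasoning

  2≤∣arc∣⁻ : ∀ {i c} → c ≤ N → 2 ≤ ∣ arc i c ∣ → 2 ≤ c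
  2≤∣arc∣⁻ {i} {c} c≤N size with 2≤∣p∣⇒distinct (arc i c) size
  ... | x , y , x≢y , x∈ , y∈ = distinct<⇒2≤ (x≢y ∘ dist-injective i) (∈-arc⁻ c≤N x∈) (∈-arc⁻ c≤N y∈)

  2≤∣arc∣⁺ : ∀ {i c} → 2 ≤ c → c ≤ N → 2 ≤ ∣ arc i c ∣
  2≤∣arc∣⁺ {i} {c} 2≤c c≤N = distinct⇒2≤∣p∣ i≢shift
      (∈-arc⁺ (subst (_< c) (sym (dist-self i)) (≤-trans (s≤s z≤n) 2≤c)))
      (∈-arc⁺ (subst (_< c) (sym dist≡1) 2≤c))
    where
    dist≡1 : dist i (shift i 1) ≡ 1
    dist≡1 = dist-shift i (≤-trans 2≤c c≤N)
    i≢shift : i ≢ shift i 1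
    i≢shift eq = 0≢1+n (trans (sym (dist-self i)) (trans (cong (dist i) eq) dist≡1))

  -- a + b ≤ N + 1 is what prevents the two arcs from overlapping at both ends
  arc-∩ : ∀ {i j a b} → dist i j < a → a ≤ N → b ≤ N → a + b ≤ suc N →
          arc i a ∩ arc j b ≡ arc j (b ⊓ (a ∸ dist i j))
  arc-∩ {i} {j} {a} {b} s<a a≤N b≤N a+b≤1+N = ⊆-antisym l⊆r r⊆l
    where
    s = dist i j
    l⊆r : ∀ {x} → x ∈ arc i a ∩ arc j b → x ∈ arc j (b ⊓ (a ∸ s))
    l⊆r {x} x∈ with x∈p∩q⁻ (arc i a) (arc j b) x∈
    ... | x∈₁ , x∈₂ =
      ∈-arc⁺ (⊓-glb o<b (m+n≤o⇒m≤o∸n (suc (dist j x)) (≤-trans (≤-reflexive (cong suc (+-comm _ s))) s+o<a)))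
      where
      o<b : dist j x < b
      o<b = ∈-arc⁻ b≤N x∈₂
      s+o<N : s + dist j x < N
      s+o<N = ≤-pred (≤-trans (≤-reflexive (cong suc (sym (+-suc s _)))) (≤-trans (+-mono-≤ s<a o<b) a+b≤1+N))
      s+o<a : s + dist j x < a
      s+o<a = subst (_< a) (dist-trans-< i j x s+o<N) (∈-arc⁻ a≤N x∈₁)
    r⊆l : ∀ {x} → x ∈ arc j (b ⊓ (a ∸ s)) → x ∈ arc i a ∩ arc j b
    r⊆l {x} x∈ = x∈p∩q⁺ (∈-arc⁺ (subst (_< a) (sym (dist-trans-< i j x (≤-trans s+o<a a≤N))) s+o<a) ,
                       ∈-arc⁺ (m<n⊓o⇒m<n b _ o<c))
      where
      o<c : dist j x < b ⊓ (a ∸ s)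
      o<c = ∈-arc⁻ (≤-trans (m⊓n≤m b _) b≤N) x∈
      s+o<a : s + dist j x < a
      s+o<a = subst (_≤ a) (cong suc (+-comm _ s)) (m≤o∸n⇒m+n≤o (suc (dist j x)) (<⇒≤ s<a) (m<n⊓o⇒m<o b _ o<c))

  disjoint-arcs : ∀ {i j a b x} → a ≤ N → b ≤ N → a ≤ dist i j → b ≤ dist j i → x ∈ arc i a → x ∈ arc j b → ⊥
  disjoint-arcs {i} {j} {a} {b} {x} a≤N b≤N a≤s b≤s′ x∈₁ x∈₂ with i ≟ᶠ j
  ... | yes refl = <⇒≱ (∈-arc⁻ a≤N x∈₁) (≤-trans (subst (a ≤_) (dist-self i) a≤s) z≤n)
  ... | no i≢j =
    <⇒≱ (∈-arc⁻ a≤N x∈₁) (subst (a ≤_) (sym (dist-trans-< i j x s+o<N)) (≤-trans a≤s (m≤m+n _ _)))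
    where
    s+o<N : dist i j + dist j x < N
    s+o<N = subst (dist i j + dist j x <_) (dist-round-trip i≢j) (+-monoʳ-< (dist i j) (≤-trans (∈-arc⁻ b≤N x∈₂) b≤s′))

  record ArcsUpTo (m : ℕ) (H : Hypergraph N) : Set where
    field
      edge⇒arc : ∀ {e} → H e → ∃₂ λ i c → c ≤ m × e ≡ arc i c
      arc⇒edge : ∀ i → H (arc i m)

  HCycle-arcs : ∀ d → ArcsUpTo d (HCycle N d)
  HCycle-arcs d = record { edge⇒arc = λ (i , e≡) → i , d , ≤-refl , e≡ ; arc⇒edge = λ i → i , refl }

  CycleUnion-arcs : ∀ {m} → 2 ≤ m → ArcsUpTo m (CycleUnion N m)
  CycleUnion-arcs {m} 2≤m = record
    { edge⇒arc = λ (c , _ , c≤m , i , e≡) → i , c , c≤m , e≡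
    ; arc⇒edge = λ i → m , 2≤m , ≤-refl , i , refl
    }

  module _ {m : ℕ} (2m≤1+N : m + m ≤ suc N) {H : Hypergraph N} (arcs : ArcsUpTo m H) where
    open ArcsUpTo arcs

    m≤N : m ≤ N
    m≤N = m+m≤1+n⇒m≤n 2m≤1+N

    overlapping-arcs : ∀ {i j a b} → dist i j < a → a ≤ m → b ≤ m → arc i a ≢ arc j b →
                       2 ≤ ∣ arc i a ∩ arc j b ∣ → CycleUnion N (pred m) (arc i a ∩ arc j b)
    overlapping-arcs {i} {j} {a} {b} s<a a≤m b≤m arcs≢ size =
      c , 2≤arc-∩ , suc[m]≤n⇒m≤pred[n] c<m , j , ∩≡
      where
      c = b ⊓ (a ∸ dist i j)
      ∩≡ : arc i a ∩ arc j b ≡ arc j c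
      ∩≡ = arc-∩ s<a (≤-trans a≤m m≤N) (≤-trans b≤m m≤N) (≤-trans (+-mono-≤ a≤m b≤m) 2m≤1+N)
      2≤arc-∩ : 2 ≤ c
      2≤arc-∩ = 2≤∣arc∣⁻ (≤-trans (m⊓n≤m b _) (≤-trans b≤m m≤N)) (subst (λ e → 2 ≤ ∣ e ∣) ∩≡ size)
      c<m : c < m
      c<m = b⊓[a∸s]<m (dist i j) s<a a≤m b≤m
        (λ s≡0 a≡b → arcs≢ (cong₂ arc (dist-injective i (trans (dist-self i) (sym s≡0))) a≡b))

    EI-arcs⊆ : ∀ {e} → EI H e → CycleUnion N (pred m) e
    EI-arcs⊆ (_ , _ , h₁ , h₂ , e₁≢e₂ , refl , size) with edge⇒arc h₁ | edge⇒arc h₂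
    ... | i , a , a≤m , refl | j , b , b≤m , refl with dist i j <? a | dist j i <? b
    ... | yes s<a | _ = overlapping-arcs s<a a≤m b≤m e₁≢e₂ size
    ... | no _ | yes s′<b = subst (CycleUnion N (pred m)) (∩-comm (arc j b) (arc i a))
          (overlapping-arcs s′<b b≤m a≤m (e₁≢e₂ ∘ sym) (subst (λ e → 2 ≤ ∣ e ∣) (∩-comm (arc i a) (arc j b)) size))
    ... | no s≮a | no s′≮b with 1≤∣p∣⇒nonempty _ (≤-trans (n≤1+n 1) size)
    ...   | x , x∈ = ⊥-elim (disjoint-arcs (≤-trans a≤m m≤N) (≤-trans b≤m m≤N) (≮⇒≥ s≮a) (≮⇒≥ s′≮b)
                       (proj₁ (x∈p∩q⁻ (arc i a) (arc j b) x∈)) (proj₂ (x∈p∩q⁻ (arc i a) (arc j b) x∈)))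

    -- arc i m is the arc of length m that ends where arc j c ends
    EI-arcs⊇ : ∀ {e} → CycleUnion N (pred m) e → EI H e
    EI-arcs⊇ (c , 2≤c , c≤pred[m] , j , refl) =
      arc i m , arc j m , arc⇒edge i , arc⇒edge j , arcs≢ , sym ∩≡ , 2≤∣arc∣⁺ 2≤c c≤N
      where
      c<m : c < m
      c<m = ≤pred⇒< (≤-trans (n≤1+n 1) 2≤c) c≤pred[m]
      c≤N : c ≤ N
      c≤N = ≤-trans (<⇒≤ c<m) m≤N
      s = m ∸ c
      s<m : s < m
      s<m = ∸-monoʳ-< {m} {c} {0} (≤-trans (n≤1+n 1) 2≤c) (<⇒≤ c<m)
      i = shift j (N ∸ s)
      ∩≡ : arc i m ∩ arc j m ≡ arc j c
      ∩≡ = begin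
        arc i m ∩ arc j m          ≡⟨ arc-∩ (subst (_< m) (sym (dist-back j (≤-trans s<m m≤N))) s<m) m≤N m≤N 2m≤1+N ⟩
        arc j (m ⊓ (m ∸ dist i j)) ≡⟨ cong (λ t → arc j (m ⊓ (m ∸ t))) (dist-back j (≤-trans s<m m≤N)) ⟩
        arc j (m ⊓ (m ∸ s))        ≡⟨ cong (λ t → arc j (m ⊓ t)) (m∸[m∸n]≡n (<⇒≤ c<m)) ⟩
        arc j (m ⊓ c)              ≡⟨ cong (arc j) (m≥n⇒m⊓n≡n (<⇒≤ c<m)) ⟩
        arc j c                    ∎
        where open ≡-Reasoning
      arcs≢ : arc i m ≢ arc j m
      arcs≢ eq = <-irrefl (dist-shift j c<N)
        (∈-arc⁻ c≤N (subst (shift j c ∈_) arc-m≡arc-c (∈-arc⁺ (subst (_< m) (sym (dist-shift j c<N)) c<m))))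
        where
        c<N : c < N
        c<N = ≤-trans c<m m≤N
        arc-m≡arc-c : arc j m ≡ arc j c
        arc-m≡arc-c = trans (sym (∩-idem (arc j m))) (trans (cong (_∩ arc j m) (sym eq)) ∩≡)

    EI-arcs : EI H ≅ CycleUnion N (pred m)
    EI-arcs e = EI-arcs⊆ , EI-arcs⊇

  EI^-HCycle : ∀ {d} → d + d ≤ suc N → ∀ k → suc k < d → EI^ (suc k) (HCycle N d) ≅ CycleUnion N (d ∸ suc k)
  EI^-HCycle {d} 2d≤1+N zero _ =
    subst (λ m → EI (HCycle N d) ≅ CycleUnion N m) (pred[m∸n]≡m∸[1+n] d 0) (EI-arcs 2d≤1+N (HCycle-arcs d))
  EI^-HCycle {d} 2d≤1+N (suc k) k+2<d =
    subst (λ m → EI^ (suc (suc k)) (HCycle N d) ≅ CycleUnion N m) (pred[m∸n]≡m∸[1+n] d (suc k))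
      (≅-trans (EI-cong (EI^-HCycle 2d≤1+N k (≤-trans (n≤1+n _) k+2<d)))
               (EI-arcs (≤-trans (+-mono-≤ (m∸n≤m d (suc k)) (m∸n≤m d (suc k))) 2d≤1+N)
                        (CycleUnion-arcs (m+n≤o⇒m≤o∸n 2 k+2<d))))

  IsEINumber-HCycle : ∀ {d} → d + d ≤ suc N → 2 ≤ d → IsEINumber (HCycle N d) (d ∸ 1)
  IsEINumber-HCycle {suc (suc d)} 2d≤1+N (s≤s (s≤s z≤n)) = no-edges , has-edges
    where
    no-edges : NoEdges (EI^ (suc d) (HCycle N (suc (suc d))))
    no-edges e edge with proj₁ (EI^-HCycle 2d≤1+N d ≤-refl e) edge
    ... | c , 2≤c , c≤1 , _ = <⇒≱ 2≤c (≤-trans c≤1 (m≤n+o⇒m∸n≤o (suc d) d (≤-reflexive (+-comm 1 d))))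
    has-edges : ∀ j → j < suc d → ¬ NoEdges (EI^ j (HCycle N (suc (suc d))))
    has-edges zero _ noEdges = noEdges _ (fromℕ< (>-nonZero⁻¹ N) , refl)
    has-edges (suc j) (s≤s j<d) noEdges = noEdges _
      (proj₂ (EI^-HCycle 2d≤1+N j (s≤s (≤-trans j<d (n≤1+n d))) _)
        (ArcsUpTo.arc⇒edge (CycleUnion-arcs (m+n≤o⇒m≤o∸n 2 (s≤s (s≤s j<d)))) (fromℕ< (>-nonZero⁻¹ N))))

2*d∸1≤n⇒d+d≤1+n : ∀ d n → 2 * d ∸ 1 ≤ n → d + d ≤ suc n
2*d∸1≤n⇒d+d≤1+n d n h = begin
  d + d             ≡⟨ cong (d +_) (+-identityʳ d) ⟨
  2 * d             ≤⟨ m≤n+m∸n (2 * d) 1 ⟩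
  suc (2 * d ∸ 1)   ≤⟨ s≤s h ⟩
  suc n             ∎
  where open ≤-Reasoning

n<2*d∸1⇒2+n≤d+d : ∀ d n → 1 ≤ d → n < 2 * d ∸ 1 → 2 + n ≤ d + d
n<2*d∸1⇒2+n≤d+d d n 1≤d h = begin
  2 + n         ≡⟨ +-comm 1 (suc n) ⟩
  suc n + 1     ≤⟨ m≤o∸n⇒m+n≤o (suc n) (≤-trans 1≤d (m≤m+n d _)) h ⟩
  2 * d         ≡⟨ cong (d +_) (+-identityʳ d) ⟩
  d + d         ∎
  where open ≤-Reasoning

theorem4 : (n d : ℕ) .{{_ : NonZero n}} → 1 ≤ d →
    ((3 ≤ d → 2 * d ∸ 1 ≤ n → ∀ k → 1 ≤ k → k ≤ d ∸ 2 →
        EI^ k (HCycle n d) ≅ CycleUnion n (d ∸ k))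
    × (2 ≤ d → 2 * d ∸ 1 ≤ n → IsEINumber (HCycle n d) (d ∸ 1))
    × (2 ≤ d → d ≤ n →
        (2 * d ∸ 1 ≤ n → IsEINumber (HPath n d) (d ∸ 1))
        × (n < 2 * d ∸ 1 → IsEINumber (HPath n d) (n ∸ d + 1))))
theorem4 n d 1≤d = cycle-layers , cycle-number , λ 2≤d d≤n → long-path 2≤d , short-path 2≤d d≤n
  where
  open Cycle n
  cycle-layers : 3 ≤ d → 2 * d ∸ 1 ≤ n → ∀ k → 1 ≤ k → k ≤ d ∸ 2 → EI^ k (HCycle n d) ≅ CycleUnion n (d ∸ k)
  cycle-layers (s≤s (s≤s (s≤s _))) h (suc k) _ k≤ =
    EI^-HCycle (2*d∸1≤n⇒d+d≤1+n d n h) k (s≤s (≤-trans k≤ (n≤1+n _)))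
  cycle-number : 2 ≤ d → 2 * d ∸ 1 ≤ n → IsEINumber (HCycle n d) (d ∸ 1)
  cycle-number 2≤d h = IsEINumber-HCycle (2*d∸1≤n⇒d+d≤1+n d n h) 2≤d
  long-path : 2 ≤ d → 2 * d ∸ 1 ≤ n → IsEINumber (HPath n d) (d ∸ 1)
  long-path 2≤d@(s≤s (s≤s {n = d′} _)) h =
    IsEINumber-HPath (suc d′) 2≤d (λ (3+d′≤2+d′ , _) → <-irrefl refl 3+d′≤2+d′)
      λ j j<1+d′ → s≤s j<1+d′ ,
        ≤-trans (+-monoˡ-≤ d (≤-pred j<1+d′)) (≤-trans (n≤1+n _) (≤-pred (2*d∸1≤n⇒d+d≤1+n d n h)))
  short-path : 2 ≤ d → d ≤ n → n < 2 * d ∸ 1 → IsEINumber (HPath n d) (n ∸ d + 1)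
  short-path 2≤d d≤n h = subst (IsEINumber (HPath n d)) (+-comm 1 (n ∸ d))
    (IsEINumber-HPath (suc (n ∸ d)) 2≤d
      (λ (_ , 1+n≤n) → <-irrefl refl (subst (_≤ n) (cong suc (m∸n+n≡m d≤n)) 1+n≤n)) bounds)
    where
    bounds : ∀ j → j < suc (n ∸ d) → 2 + j ≤ d × j + d ≤ n
    bounds j j<1+n∸d = +-cancelʳ-≤ d (2 + j) d (≤-trans (s≤s (s≤s j+d≤n)) (n<2*d∸1⇒2+n≤d+d d n 1≤d h)) , j+d≤n
      where
      j+d≤n : j + d ≤ n
      j+d≤n = m≤o∸n⇒m+n≤o j d≤n (≤-pred j<1+n∸d)
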